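{- Let $k\ge 0$ and $n\ge 3k+1$ be integers, and let $w$ be a composition of $n$ having fewer than $k$ entries equal to $1$. Then $w$ is uniquely determined by its set of $k$-deletions: if $w'$ is any composition whose set of $k$-deletions equals that of $w$, then $w'=w$.
   Context: A composition is a finite word $w=w(1)w(2)\cdots w(m)$ whose letters are positive integers; it is a composition of $n$ if $w(1)+\cdots+w(m)=n$. A $1$-deletion of $w$ is a composition obtained from $w$ either by lowering an entry that is $\ge 2$ by $1$, or by removing an entry equal to $1$. For $k\ge 0$, the $k$-deletions of $w$ are defined recursively: the only $0$-deletion of $w$ is $w$ itself, and a $k$-deletion is a $1$-deletion of a $(k-1)$-deletion. -}

module Defs where

open import Data.Nat using (ℕ; zero; suc; _≤_; _<_)
open import Data.List using (List; []; _∷_; length; filter)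
open import Data.Nat.ListAction using (sum)
open import Data.Product using (_×_)
open import Relation.Binary.PropositionalEquality using (_≡_)
open import Data.List.Relation.Unary.All using (All)
open import Data.Nat.Properties using (_≟_)

IsComposition : List ℕ → Set
IsComposition w = All (λ x → 1 ≤ x) w

IsCompositionOf : ℕ → List ℕ → Set
IsCompositionOf n w = IsComposition w × sum w ≡ n

ones : List ℕ → ℕ
ones w = length (filter (_≟ 1) w)

data OneDel : List ℕ → List ℕ → Set where
  lower  : ∀ {a} (xs : List ℕ) → OneDel (suc (suc a) ∷ xs) (suc a ∷ xs)
  remove : (xs : List ℕ) → OneDel (1 ∷ xs) xs
  skip   : ∀ x {xs ys} → OneDel xs ys → OneDel (x ∷ xs) (x ∷ ys)

data KDel : ℕ → List ℕ → List ℕ → Set where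
  zero-del : ∀ {w} → KDel zero w w
  suc-del  : ∀ {k w u v} → KDel k w u → OneDel u v → KDel (suc k) w v

-- Let m be the length of w and n its sum. Each entry other than a 1 contributes at least 2,
-- so 2m ≤ n + #1s; with #1s < k and 3k + 1 ≤ n this gives n = m + (d + 1) + k for some d.
-- The k-deletions of w of length m are exactly the entrywise lowerings of w (positive
-- entries) of total m + d + 1. Hence w′ has the same sum and length as w, and the entrywise
-- maxima of these lowerings, min(wᵢ, d + 2) and min(w′ᵢ, d + 2), coincide. If at most one
-- entry of w reaches d + 2, this capped word and the sum recover w. Otherwise refining the
-- count shows that no entry of w exceeds d + 2, so w is its own cap, w ≤ w′ entrywise,
-- and equal sums force w′ = w.

module Submission where

open import Defs
open import Data.Nat using (ℕ; zero; suc; _+_; _*_; _∸_; _⊓_; _≤_; _<_; _≤‴_; ≤‴-refl; ≤‴-step; z≤n; s≤s; s≤s⁻¹; z<s; _≤?_)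
open import Data.Nat.Properties
open import Data.Nat.Tactic.RingSolver using (solve-∀)
open import Algebra.Properties.CommutativeSemigroup +-commutativeSemigroup using (x∙yz≈y∙xz; interchange)
open import Data.Nat.ListAction using (sum)
open import Data.List using (List; []; _∷_; length; map)
open import Data.List.Properties using (∷-injectiveˡ; ∷-injectiveʳ)
open import Data.List.Relation.Unary.All using (All; []; _∷_)
open import Data.List.Relation.Binary.Pointwise as Pointwise
  using (Pointwise; []; _∷_; Pointwise-≡⇒≡; Pointwise-length)
open import Data.Product using (∃; ∃-syntax; _×_; _,_; proj₂; -,_)
open import Data.Sum using (inj₁; inj₂)
open import Data.Empty using (⊥; ⊥-elim)
open import Function using (_∘_)
open import Function.Bundles using (_⇔_; Equivalence)
open import Relation.Binary.PropositionalEquality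
open import Relation.Nullary using (yes; no)

infix 4 _≤*_

_≤*_ : List ℕ → List ℕ → Set
_≤*_ = Pointwise _≤_

≤*-refl : ∀ {w} → w ≤* w
≤*-refl = Pointwise.refl ≤-refl

≤*-trans : ∀ {u v w} → u ≤* v → v ≤* w → u ≤* w
≤*-trans = Pointwise.transitive ≤-trans

length≤sum : ∀ {w} → IsComposition w → length w ≤ sum w
length≤sum []       = z≤n
length≤sum (p ∷ ps) = +-mono-≤ p (length≤sum ps)

OneDel-sum : ∀ {u v} → OneDel u v → suc (sum v) ≡ sum u
OneDel-sum (lower xs)  = refl
OneDel-sum (remove xs) = refl
OneDel-sum (skip x d)  = trans (sym (+-suc x _)) (cong (x +_) (OneDel-sum d))

KDel-sum : ∀ {k w v} → KDel k w v → sum v + k ≡ sum w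
KDel-sum zero-del = +-identityʳ _
KDel-sum {w = w} (suc-del {k} {u = u} {v} d o) = begin
  sum v + suc k   ≡⟨ +-suc (sum v) k ⟩
  suc (sum v) + k ≡⟨ cong (_+ k) (OneDel-sum o) ⟩
  sum u + k       ≡⟨ KDel-sum d ⟩
  sum w           ∎
  where open ≡-Reasoning

OneDel-composition : ∀ {u v} → IsComposition u → OneDel u v → IsComposition v
OneDel-composition (_ ∷ ps) (lower xs)  = s≤s z≤n ∷ ps
OneDel-composition (_ ∷ ps) (remove xs) = ps
OneDel-composition (p ∷ ps) (skip x d)  = p ∷ OneDel-composition ps d

KDel-composition : ∀ {k w v} → IsComposition w → KDel k w v → IsComposition v
KDel-composition pw zero-del      = pw
KDel-composition pw (suc-del d o) = OneDel-composition (KDel-composition pw d) o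

OneDel-length : ∀ {u v} → OneDel u v → length v ≤ length u
OneDel-length (lower xs)  = ≤-refl
OneDel-length (remove xs) = n≤1+n _
OneDel-length (skip x d)  = s≤s (OneDel-length d)

OneDel-≤* : ∀ {u v} → OneDel u v → length v ≡ length u → v ≤* u
OneDel-≤* (lower xs)  _  = n≤1+n _ ∷ ≤*-refl
OneDel-≤* (remove xs) eq = ⊥-elim (1+n≰n (≤-reflexive (sym eq)))
OneDel-≤* (skip x d)  eq = ≤-refl ∷ OneDel-≤* d (suc-injective eq)

KDel-length : ∀ {k w v} → KDel k w v → length v ≤ length w
KDel-length zero-del      = ≤-refl
KDel-length (suc-del d o) = ≤-trans (OneDel-length o) (KDel-length d)

KDel-≤* : ∀ {k w v} → KDel k w v → length v ≡ length w → v ≤* w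
KDel-≤* zero-del      _  = ≤*-refl
KDel-≤* (suc-del d o) eq = ≤*-trans (OneDel-≤* o (trans eq (sym lu≡lw))) (KDel-≤* d lu≡lw)
  where
  lu≡lw = ≤-antisym (KDel-length d) (≤-trans (≤-reflexive (sym eq)) (OneDel-length o))

KDel-trans : ∀ {a b x y z} → KDel a x y → KDel b y z → KDel (b + a) x z
KDel-trans d zero-del      = d
KDel-trans d (suc-del e o) = suc-del (KDel-trans d e) o

KDel-∷ : ∀ {k xs ys} x → KDel k xs ys → KDel k (x ∷ xs) (x ∷ ys)
KDel-∷ x zero-del      = zero-del
KDel-∷ x (suc-del d o) = suc-del (KDel-∷ x d) (skip x o)

KDel-lowerHead : ∀ {a x} xs → suc a ≤‴ x → ∃[ j ] KDel j (x ∷ xs) (suc a ∷ xs)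
KDel-lowerHead xs ≤‴-refl      = 0 , zero-del
KDel-lowerHead xs (≤‴-step lt) = let j , d = KDel-lowerHead xs lt in suc j , suc-del d (lower xs)

≤*⇒KDel : ∀ {u w} → u ≤* w → IsComposition u → ∃[ k ] KDel k w u
≤*⇒KDel [] [] = 0 , zero-del
≤*⇒KDel {w = x ∷ _} (y≤x ∷ u≤w) (s≤s z≤n ∷ pu) =
  let k , d = ≤*⇒KDel u≤w pu
      j , e = KDel-lowerHead _ (≤″⇒≤‴ (≤⇒≤″ y≤x))
  in j + k , KDel-trans (KDel-∷ x d) e

OneDel-long : ∀ {r v} → IsComposition v → r ≤ length v → r < sum v →
              ∃[ v′ ] OneDel v v′ × r ≤ length v′
OneDel-long {v = []} _ _ ()
OneDel-long {v = zero ∷ _} (() ∷ _) _ _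
OneDel-long {v = suc (suc a) ∷ vs} _ r≤ _ = suc a ∷ vs , lower vs , r≤
OneDel-long {zero}  {1 ∷ vs} _ _ _ = vs , remove vs , z≤n
OneDel-long {suc r} {1 ∷ vs} (_ ∷ pvs) (s≤s r≤) (s≤s r<) =
  let v′ , d , r≤′ = OneDel-long pvs r≤ r< in 1 ∷ v′ , skip 1 d , s≤s r≤′

KDel-long : ∀ {r k w} → IsComposition w → r ≤ length w → r + k ≤ sum w →
            ∃[ v ] KDel k w v × r ≤ length v
KDel-long {k = zero}  pw r≤ _ = -, zero-del , r≤
KDel-long {r} {suc k} {w} pw r≤ r+k<
  with KDel-long {k = k} pw r≤ (≤-trans (+-monoʳ-≤ r (n≤1+n k)) r+k<)
... | v , d , r≤v =
  let v′ , o , r≤v′ = OneDel-long (KDel-composition pw d) r≤v r<sum in v′ , suc-del d o , r≤v′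
  where
  r<sum : r < sum v
  r<sum = +-cancelʳ-≤ k (suc r) (sum v)
            (≤-trans (≤-reflexive (sym (+-suc r k))) (≤-trans r+k< (≤-reflexive (sym (KDel-sum d)))))

Lowering : ℕ → List ℕ → List ℕ → Set
Lowering t w u = u ≤* w × IsComposition u × sum u ≡ t

Lowering⇒KDel : ∀ {t k w u} → Lowering t w u → t + k ≡ sum w → KDel k w u
Lowering⇒KDel {k = k} {u = u} (u≤w , pu , refl) eq =
  let k′ , d = ≤*⇒KDel u≤w pu
  in subst (λ j → KDel j _ u) (+-cancelˡ-≡ (sum u) k′ k (trans (KDel-sum d) (sym eq))) d

Lowering-∷ : ∀ {h x t xs v} → 1 ≤ h → h ≤ x → Lowering t xs v → Lowering (h + t) (x ∷ xs) (h ∷ v)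
Lowering-∷ 1≤h h≤x (v≤xs , pv , refl) = h≤x ∷ v≤xs , 1≤h ∷ pv , refl

m+[n∸o]≤p : ∀ {m n o p} → m ≤ p → m + n ≤ o + p → m + (n ∸ o) ≤ p
m+[n∸o]≤p {o = zero} _ le = le
m+[n∸o]≤p {m} {zero} {suc o} m≤p _ = ≤-trans (≤-reflexive (+-identityʳ m)) m≤p
m+[n∸o]≤p {m} {suc n} {suc o} m≤p le = m+[n∸o]≤p m≤p (s≤s⁻¹ (≤-trans (≤-reflexive (sym (+-suc m n))) le))

Lowering-exists : ∀ e {w} → IsComposition w → length w + e ≤ sum w → ∃ (Lowering (length w + e) w)

Lowering-maxHead : ∀ e {a xs} → IsComposition xs → length xs + e ≤ a + sum xs →
                   ∃[ v ] Lowering (suc (length xs + e)) (suc a ∷ xs) (suc a ⊓ suc e ∷ v)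

Lowering-exists zero    {[]}           []        _         = -, [] , [] , refl
Lowering-exists (suc e) {[]}           []        ()
Lowering-exists e       {zero ∷ _}     (() ∷ _)  _
Lowering-exists e       {suc a ∷ xs}   (_ ∷ pxs) (s≤s le) = -, proj₂ (Lowering-maxHead e pxs le)

Lowering-maxHead e {a} {xs} pxs le =
  let v , lv = Lowering-exists (e ∸ a) pxs (m+[n∸o]≤p (length≤sum pxs) le)
  in v , subst (λ t → Lowering (suc t) (suc a ∷ xs) (suc (a ⊓ e) ∷ v)) total
           (Lowering-∷ (s≤s z≤n) (s≤s (m⊓n≤m a e)) lv)
  where
  open ≡-Reasoning
  total : a ⊓ e + (length xs + (e ∸ a)) ≡ length xs + e
  total = begin
    a ⊓ e + (length xs + (e ∸ a)) ≡⟨ x∙yz≈y∙xz (a ⊓ e) (length xs) (e ∸ a) ⟩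
    length xs + (a ⊓ e + (e ∸ a)) ≡⟨ cong (length xs +_) (m⊓n+n∸m≡n a e) ⟩
    length xs + e                 ∎

cap : ℕ → List ℕ → List ℕ
cap c = map (_⊓ c)

cap-≤* : ∀ {c} w → cap c w ≤* w
cap-≤* []       = []
cap-≤* (x ∷ xs) = m⊓n≤m x _ ∷ cap-≤* xs

Lowering-envelope : ∀ e {w w′} → IsComposition w → length w + e ≤ sum w →
                    (∀ {u} → Lowering (length w + e) w u → u ≤* w′) → cap (suc e) w ≤* w′
Lowering-envelope zero    {[]}         []        _        below = below ([] , [] , refl)
Lowering-envelope (suc e) {[]}         []        ()       _
Lowering-envelope e       {zero ∷ _}   (() ∷ _)  _        _
Lowering-envelope e       {suc a ∷ xs} (_ ∷ pxs) (s≤s le) below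
  with below (proj₂ (Lowering-maxHead e pxs le))
Lowering-envelope e {suc a ∷ xs} {x′ ∷ xs′} (_ ∷ pxs) (s≤s le) below | head≤ ∷ _ = head≤ ∷ tail≤
  where
  tail≤ : cap (suc e) xs ≤* xs′
  tail≤ with length xs + e ≤? sum xs
  ... | yes fits = Lowering-envelope e pxs fits (Pointwise.tail ∘ below ∘ Lowering-∷ ≤-refl (s≤s z≤n))
  ... | no ¬fits = ≤*-trans (cap-≤* xs) (Pointwise.tail (below lowering))
    -- xs is too small to absorb the excess e, so some lowering leaves xs untouched.
    where
    h = length xs + e ∸ sum xs
    h≤a : h ≤ a
    h≤a = m≤n+o⇒m∸n≤o (length xs + e) (sum xs) (≤-trans le (≤-reflexive (+-comm a (sum xs))))
    lowering : Lowering (suc (length xs + e)) (suc a ∷ xs) (suc h ∷ xs)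
    lowering = subst (λ t → Lowering (suc t) (suc a ∷ xs) (suc h ∷ xs)) (m∸n+n≡m (<⇒≤ (≰⇒> ¬fits)))
                 (Lowering-∷ (s≤s z≤n) (s≤s h≤a) (≤*-refl , pxs , refl))

cap-mono : ∀ {c w w′} → cap c w ≤* w′ → cap c w ≤* cap c w′
cap-mono {w = []}    []       = []
cap-mono {c} {x ∷ _} (p ∷ ps) = ⊓-glb p (m⊓n≤n x c) ∷ cap-mono ps

cap-antisym : ∀ {c w w′} → cap c w ≤* w′ → cap c w′ ≤* w → cap c w ≡ cap c w′
cap-antisym p q = Pointwise-≡⇒≡ (Pointwise.antisymmetric ≤-antisym (cap-mono p) (cap-mono q))

≤*-sum : ∀ {u w} → u ≤* w → sum u ≤ sum w
≤*-sum []       = z≤n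
≤*-sum (p ∷ ps) = +-mono-≤ p (≤*-sum ps)

≤*∧sum≡⇒≡ : ∀ {u w} → u ≤* w → sum u ≡ sum w → u ≡ w
≤*∧sum≡⇒≡ [] _ = refl
≤*∧sum≡⇒≡ {x ∷ xs} {y ∷ ys} (x≤y ∷ xs≤ys) eq = cong₂ _∷_ x≡y (≤*∧sum≡⇒≡ xs≤ys (+-cancelˡ-≡ x _ _ tails))
  where
  y≤x : y ≤ x
  y≤x = +-cancelʳ-≤ (sum xs) y x (≤-trans (+-monoʳ-≤ y (≤*-sum xs≤ys)) (≤-reflexive (sym eq)))
  x≡y : x ≡ y
  x≡y = ≤-antisym x≤y y≤x
  tails : x + sum xs ≡ x + sum ys
  tails = trans eq (cong (_+ sum ys) (sym x≡y))

overflow : ℕ → List ℕ → ℕ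
overflow c w = sum (map (_∸ c) w)

overflow≡0⇒cap≡ : ∀ {c} w → overflow c w ≡ 0 → cap c w ≡ w
overflow≡0⇒cap≡     []       _  = refl
overflow≡0⇒cap≡ {c} (x ∷ xs) eq =
  cong₂ _∷_ (m≤n⇒m⊓n≡m (m∸n≡0⇒m≤n (m+n≡0⇒m≡0 (x ∸ c) eq))) (overflow≡0⇒cap≡ xs (m+n≡0⇒n≡0 (x ∸ c) eq))

overflow≡0⇒cap-sum-injective : ∀ {c w w′} → overflow c w ≡ 0 → cap c w ≡ cap c w′ → sum w ≡ sum w′ → w ≡ w′
overflow≡0⇒cap-sum-injective {c} {w} {w′} none caps sums =
  ≤*∧sum≡⇒≡ (subst (_≤* w′) (trans (sym caps) (overflow≡0⇒cap≡ w none)) (cap-≤* w′)) sums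

atLeast : ℕ → List ℕ → ℕ
atLeast c []       = 0
atLeast c (x ∷ xs) with c ≤? x
... | yes _ = suc (atLeast c xs)
... | no  _ = atLeast c xs

⊓-cancelʳ-< : ∀ {x c x′} → x < c → x ⊓ c ≡ x′ ⊓ c → x ≡ x′
⊓-cancelʳ-< {x} {c} {x′} x<c eq with ⊓-sel x′ c
... | inj₁ x′⊓c≡x′ = trans (sym (m≤n⇒m⊓n≡m (<⇒≤ x<c))) (trans eq x′⊓c≡x′)
... | inj₂ x′⊓c≡c  = ⊥-elim (<-irrefl (trans (sym (m≤n⇒m⊓n≡m (<⇒≤ x<c))) (trans eq x′⊓c≡c)) x<c)

atLeast≡0⇒cap-injective : ∀ {c w w′} → atLeast c w ≡ 0 → cap c w ≡ cap c w′ → w ≡ w′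
atLeast≡0⇒cap-injective {w = []}    {[]}    _ _ = refl
atLeast≡0⇒cap-injective {w = []}    {_ ∷ _} _ ()
atLeast≡0⇒cap-injective {w = _ ∷ _} {[]}    _ ()
atLeast≡0⇒cap-injective {c} {x ∷ xs} {x′ ∷ xs′} none caps with c ≤? x
atLeast≡0⇒cap-injective {c} {x ∷ xs} {x′ ∷ xs′} () caps | yes _
... | no x≱c = cong₂ _∷_ (⊓-cancelʳ-< (≰⇒> x≱c) (∷-injectiveˡ caps))
                         (atLeast≡0⇒cap-injective none (∷-injectiveʳ caps))

atLeast≤1⇒cap-sum-injective : ∀ {c w w′} → atLeast c w ≤ 1 → cap c w ≡ cap c w′ → sum w ≡ sum w′ → w ≡ w′
atLeast≤1⇒cap-sum-injective {w = []}    {[]}    _ _ _ = refl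
atLeast≤1⇒cap-sum-injective {w = []}    {_ ∷ _} _ () _
atLeast≤1⇒cap-sum-injective {w = _ ∷ _} {[]}    _ () _
atLeast≤1⇒cap-sum-injective {c} {x ∷ xs} {x′ ∷ xs′} few caps sums with c ≤? x
... | yes _ = cong₂ _∷_ (+-cancelʳ-≡ (sum xs) x x′ (trans sums (cong (λ ys → x′ + sum ys) (sym tails)))) tails
  where
  tails : xs ≡ xs′
  tails = atLeast≡0⇒cap-injective (n≤0⇒n≡0 (s≤s⁻¹ few)) (∷-injectiveʳ caps)
... | no x≱c = cong₂ _∷_ heads
                 (atLeast≤1⇒cap-sum-injective few (∷-injectiveʳ caps)
                   (+-cancelˡ-≡ x _ _ (trans sums (cong (_+ sum xs′) (sym heads)))))
  where
  heads : x ≡ x′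
  heads = ⊓-cancelʳ-< (≰⇒> x≱c) (∷-injectiveˡ caps)

counting-step : ∀ l o y d s z {a δ x ω} → 2 + a + δ * d ≤ x + ω → l + l + o + y * d ≤ s + z →
                suc l + suc l + (a + o) + (δ + y) * d ≤ (x + s) + (ω + z)
counting-step l o y d s z {a} {δ} {x} {ω} head tail = begin
  suc l + suc l + (a + o) + (δ + y) * d     ≡⟨ regroupˡ l a o y δ d ⟩
  (2 + a + δ * d) + (l + l + o + y * d)     ≤⟨ +-mono-≤ head tail ⟩
  (x + ω) + (s + z)                         ≡⟨ interchange x ω s z ⟩
  (x + s) + (ω + z)                         ∎
  where
  open ≤-Reasoning
  regroupˡ : ∀ l a o y δ d → suc l + suc l + (a + o) + (δ + y) * d ≡ (2 + a + δ * d) + (l + l + o + y * d)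
  regroupˡ = solve-∀

-- Entrywise: 2 + (x ∸ (2 + d)) + [2 + d ≤ x]·d ≤ x + [x ≡ 1] whenever x ≥ 1.
double-length-bound : ∀ d {w} → IsComposition w →
  length w + length w + overflow (2 + d) w + atLeast (2 + d) w * d ≤ sum w + ones w
double-length-bound d {[]}               []       = z≤n
double-length-bound d {zero ∷ _}         (() ∷ _)
double-length-bound d {1 ∷ xs}            (_ ∷ ps) =
  counting-step (length xs) (overflow (2 + d) xs) (atLeast (2 + d) xs) d (sum xs) (ones xs)
    {δ = 0} {x = 1} {ω = 1} ≤-refl (double-length-bound d ps)
double-length-bound d {suc (suc a) ∷ xs}  (_ ∷ ps) with 2 + d ≤? 2 + a
... | yes (s≤s (s≤s d≤a)) =
  counting-step (length xs) (overflow (2 + d) xs) (atLeast (2 + d) xs) d (sum xs) (ones xs)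
    {δ = 1} {ω = 0} (≤-reflexive (cong (2 +_) exact)) (double-length-bound d ps)
  where
  exact : a ∸ d + 1 * d ≡ a + 0
  exact = trans (cong (a ∸ d +_) (*-identityˡ d)) (trans (m∸n+n≡m d≤a) (sym (+-identityʳ a)))
... | no _ =
  counting-step (length xs) (overflow (2 + d) xs) (atLeast (2 + d) xs) d (sum xs) (ones xs)
    {δ = 0} {ω = 0} (+-monoˡ-≤ 0 (s≤s (s≤s (m∸n≤m a d)))) (double-length-bound d ps)

length+length≤sum+ones : ∀ {w} → IsComposition w → length w + length w ≤ sum w + ones w
length+length≤sum+ones {w} pw =
  ≤-trans (≤-trans (m≤m+n _ (overflow 2 w)) (m≤m+n _ (atLeast 2 w * 0))) (double-length-bound 0 pw)

slack-exists : ∀ {m n z k} → m + m ≤ n + z → z < k → 3 * k + 1 ≤ n → ∃[ d ] m + suc d + k ≡ n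
slack-exists {m} {n} {z} {k} h₁ h₂ h₃ =
  let d , eq = m≤n⇒∃[o]m+o≡n k+1+m≤n in d , trans (regroup m d k) eq
  where
  open ≤-Reasoning
  regroup : ∀ m d k → m + suc d + k ≡ k + suc m + d
  regroup = solve-∀
  regroup₁ : ∀ m z k → 2 * (k + suc m) + (k + z) ≡ m + m + suc z + (3 * k + 1)
  regroup₁ = solve-∀
  regroup₂ : ∀ n z k → n + z + k + n ≡ 2 * n + (k + z)
  regroup₂ = solve-∀
  k+1+m≤n : k + suc m ≤ n
  k+1+m≤n = *-cancelˡ-≤ 2 (+-cancelʳ-≤ (k + z) (2 * (k + suc m)) (2 * n) (begin
    2 * (k + suc m) + (k + z)     ≡⟨ regroup₁ m z k ⟩
    m + m + suc z + (3 * k + 1)   ≤⟨ +-mono-≤ (+-mono-≤ h₁ h₂) h₃ ⟩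
    n + z + k + n                 ≡⟨ regroup₂ n z k ⟩
    2 * n + (k + z)               ∎))

overflow-vanishes : ∀ {m o y d k z} → m + m + o + y * d ≤ m + suc d + k + z → 2 ≤ y → z < k →
                    3 * k + 1 ≤ m + suc d + k → o ≡ 0
overflow-vanishes {m} {o} {y} {d} {k} {z} h₁ 2≤y h₂ h₃ =
  n≤0⇒n≡0 (+-cancelʳ-≤ rest o 0 (begin
    o + rest                                                   ≡⟨ regroupˡ m o d k z ⟩
    m + m + o + 2 * d + suc z + (3 * k + 1)                    ≤⟨ +-mono-≤ (+-mono-≤ h₁′ h₂) h₃ ⟩
    m + suc d + k + z + k + (m + suc d + k)                    ≡⟨ regroupʳ m d k z ⟩
    rest                                                       ∎))
  where
  open ≤-Reasoning
  rest = m + m + 2 * d + z + 3 * k + 2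
  regroupˡ : ∀ m o d k z → o + (m + m + 2 * d + z + 3 * k + 2) ≡ m + m + o + 2 * d + suc z + (3 * k + 1)
  regroupˡ = solve-∀
  regroupʳ : ∀ m d k z → m + suc d + k + z + k + (m + suc d + k) ≡ m + m + 2 * d + z + 3 * k + 2
  regroupʳ = solve-∀
  h₁′ : m + m + o + 2 * d ≤ m + suc d + k + z
  h₁′ = ≤-trans (+-monoʳ-≤ (m + m + o) (*-monoˡ-≤ d 2≤y)) h₁

Lowering⇒≤* : ∀ {t k w w′ u} → (KDel k w u → KDel k w′ u) → length w ≡ length w′ → t + k ≡ sum w →
              Lowering t w u → u ≤* w′
Lowering⇒≤* transfer lw eq l@(u≤w , _) = KDel-≤* (transfer (Lowering⇒KDel l eq)) (trans (Pointwise-length u≤w) lw)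

module SameKDeletions {k d w w′} (pw : IsComposition w) (pw′ : IsComposition w′)
                      (slack : length w + suc d + k ≡ sum w)
                      (same : ∀ v → KDel k w v ⇔ KDel k w′ v) where

  private
    to : ∀ {v} → KDel k w v → KDel k w′ v
    to = Equivalence.to (same _)

    from : ∀ {v} → KDel k w′ v → KDel k w v
    from = Equivalence.from (same _)

    fits : length w + suc d ≤ sum w
    fits = ≤-trans (m≤m+n _ k) (≤-reflexive slack)

    common : ∃[ u ] KDel k w u × length w ≤ length u
    common = KDel-long pw ≤-refl (≤-trans (+-monoˡ-≤ k (m≤m+n _ (suc d))) (≤-reflexive slack))

  sum≡ : sum w′ ≡ sum w
  sum≡ = let _ , du , _ = common in trans (sym (KDel-sum (to du))) (KDel-sum du)

  length≡ : length w′ ≡ length w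
  length≡ = ≤-antisym (≮⇒≥ longer⇒⊥) (let _ , du , m≤lu = common in ≤-trans m≤lu (KDel-length (to du)))
    where
    longer⇒⊥ : length w < length w′ → ⊥
    longer⇒⊥ m<m′ =
      let _ , dv , m<lv = KDel-long pw′ m<m′ (≤-trans (+-monoˡ-≤ k (m<m+n _ z<s)) (≤-reflexive (trans slack (sym sum≡))))
      in 1+n≰n (≤-trans m<lv (KDel-length (from dv)))

  cap≡ : cap (2 + d) w ≡ cap (2 + d) w′
  cap≡ = cap-antisym (Lowering-envelope (suc d) pw fits (Lowering⇒≤* to (sym length≡) slack))
                     (Lowering-envelope (suc d) pw′ fits′ (Lowering⇒≤* from length≡ slack′))
    where
    slack′ : length w′ + suc d + k ≡ sum w′
    slack′ = trans (cong (λ l → l + suc d + k) length≡) (trans slack (sym sum≡))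
    fits′ : length w′ + suc d ≤ sum w′
    fits′ = ≤-trans (m≤m+n _ k) (≤-reflexive slack′)

lemma3 : (k n : ℕ) → 3 * k + 1 ≤ n → (w : List ℕ) → IsCompositionOf n w → ones w < k →
         (w′ : List ℕ) → IsComposition w′ → ((v : List ℕ) → KDel k w v ⇔ KDel k w′ v) →
         w′ ≡ w
lemma3 k _ 3k+1≤n w (pw , refl) ones<k w′ pw′ same
  with d , slack ← slack-exists (length+length≤sum+ones pw) ones<k 3k+1≤n = sym w≡w′
  where
  open SameKDeletions pw pw′ slack same
  w≡w′ : w ≡ w′
  w≡w′ with atLeast (2 + d) w ≤? 1
  ... | yes few  = atLeast≤1⇒cap-sum-injective few cap≡ (sym sum≡)
  ... | no  many = overflow≡0⇒cap-sum-injective no-overflow cap≡ (sym sum≡)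
    where
    no-overflow : overflow (2 + d) w ≡ 0
    no-overflow = overflow-vanishes (≤-trans (double-length-bound d pw) (≤-reflexive (cong (_+ ones w) (sym slack))))
                    (≰⇒> many) ones<k (≤-trans 3k+1≤n (≤-reflexive (sym slack)))
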